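{- Let $\alpha\ge0$. If a deterministic learning-augmented algorithm for online packet scheduling with deadlines is $(1+\alpha)$-consistent, then its competitive ratio (over all real instances and all predictions) cannot be better than $\frac{2}{1+\alpha}$.
   Context: Problem: an instance is a collection $\mathcal{J}$ of unit-length jobs $j=(r_j,d_j,w_j)$ (integer release time, integer deadline, nonnegative weight), revealed online at their release times; at each integer time $t$ at most one job is processed and job $j$ may be processed at $t$ only if $r_j\le t\le d_j-1$; the goal is to maximize total processed weight. A learning-augmented algorithm additionally receives at time $0$ a predicted instance $\hat{\mathcal{J}}$. Its competitive ratio on $(\mathcal{J},\hat{\mathcal{J}})$ is $W(\textsc{Opt}(\mathcal{J}))/W(\text{its output})$, where $\textsc{Opt}(\mathcal{J})$ is an optimal offline schedule and $W$ denotes total weight. The algorithm is $\beta$-consistent if its competitive ratio is at most $\beta$ on every input whose prediction is exactly correct ($\hat{\mathcal{J}}=\mathcal{J}$).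
   Formalization: The parameter α and the job weights $w_j$ are rational, so each deterministic algorithm receives only instances and predictions with rational weights. -}

module Defs where

open import Function using (_∘_)
open import Data.Nat as ℕ using (ℕ; zero; suc; _⊔_; _≤?_; _<?_)
open import Data.Rational using (ℚ; 0ℚ; 1ℚ; _+_; _*_; _≤_)
open import Data.Rational.Properties using () renaming (_≟_ to _≟ℚ_)
open import Data.List using (List; []; _∷_; filter; length; lookup; foldr)
open import Data.List.Relation.Unary.All using (All)
open import Data.Maybe using (Maybe; just; nothing; maybe′)
import Data.Maybe as Maybe
open import Data.Fin using (Fin)
import Data.Fin as Fin
open import Data.Product using (_×_; _,_)
open import Relation.Nullary using (Dec; yes; no)
open import Relation.Binary.PropositionalEquality using (_≡_; refl)

-- A unit-length job (release time r, deadline d, weight w).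
-- It may be processed at integer time t iff r ≤ t ≤ d - 1.
record Job : Set where
  constructor job
  field
    r : ℕ
    d : ℕ
    w : ℚ

open Job public

Instance : Set
Instance = List Job

NonnegWeights : Instance → Set
NonnegWeights J = All (λ j → 0ℚ ≤ w j) J

_≟J_ : (a b : Job) → Dec (a ≡ b)
job r₁ d₁ w₁ ≟J job r₂ d₂ w₂ with r₁ ℕ.≟ r₂ | d₁ ℕ.≟ d₂ | w₁ ≟ℚ w₂
... | yes refl | yes refl | yes refl = yes refl
... | no p | _ | _ = no λ { refl → p refl }
... | yes _ | no p | _ = no λ { refl → p refl }
... | yes _ | yes _ | no p = no λ { refl → p refl }

released : ℕ → Instance → Instance
released t J = filter (λ j → r j ≤? t) J

-- A deterministic learning-augmented online algorithm: at each integer time t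
-- it decides (as a function of the prediction given at time 0, the current
-- time, and the jobs released so far) which job to process, or to idle.
-- Its own past decisions are determined by these data, so no extra state is needed.
-- Identical jobs are interchangeable, so naming a job by its value is fully general.
Algorithm : Set
Algorithm = (prediction : Instance) → (t : ℕ) → (seen : Instance) → Maybe Job

removeOne : Job → List Job → Maybe (List Job)
removeOne j [] = nothing
removeOne j (k ∷ ks) with j ≟J k
... | yes _ = just ks
... | no _ = Maybe.map (k ∷_) (removeOne j ks)

step : Algorithm → (Ĵ J : Instance) → ℕ → List Job → ℚ × List Job
step A Ĵ J t rem with A Ĵ t (released t J)
... | nothing = 0ℚ , rem
... | just j with r j ≤? t | t <? d j | removeOne j rem
...   | yes _ | yes _ | just rem′ = w j , rem′
...   | _ | _ | _ = 0ℚ , rem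

run : Algorithm → (Ĵ J : Instance) → (t fuel : ℕ) → List Job → ℚ
run A Ĵ J t zero rem = 0ℚ
run A Ĵ J t (suc n) rem with step A Ĵ J t rem
... | g , rem′ = g + run A Ĵ J (suc t) n rem′

-- Largest deadline: no job can be processed at any time ≥ horizon J.
horizon : Instance → ℕ
horizon = foldr (λ j m → d j ⊔ m) 0

ALG : Algorithm → (J Ĵ : Instance) → ℚ
ALG A J Ĵ = run A Ĵ J 0 (horizon J) J

Schedule : Instance → Set
Schedule J = Fin (length J) → Maybe ℕ

Feasible : (J : Instance) → Schedule J → Set
Feasible J σ =
  (∀ i t → σ i ≡ just t → (r (lookup J i) ℕ.≤ t) × (t ℕ.< d (lookup J i)))
  × (∀ i k t → σ i ≡ just t → σ k ≡ just t → i ≡ k)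

sumFin : ∀ {n} → (Fin n → ℚ) → ℚ
sumFin {zero} f = 0ℚ
sumFin {suc n} f = f Fin.zero + sumFin (f ∘ Fin.suc)

weight : (J : Instance) → Schedule J → ℚ
weight J σ = sumFin (λ i → maybe′ (λ _ → w (lookup J i)) 0ℚ (σ i))

Consistent : ℚ → Algorithm → Set
Consistent β A = ∀ (J : Instance) → NonnegWeights J →
  (σ : Schedule J) → Feasible J σ → weight J σ ≤ β * ALG A J J

-- Consider the jobs urgent p = (0,1,p), lax q = (0,2,q) and late q = (1,2,q), and give A the
-- prediction {urgent, lax, late}.  At time 0 the instances {urgent, lax} and {urgent, lax, late}
-- look the same (late is only released at time 1), so A makes the same choice in both.  If it
-- processes lax, then on the real instance {urgent, lax} urgent expires and A earns q against
-- p + q.  Otherwise, on the correctly predicted instance {urgent, lax, late} A earns at most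
-- p + q against 2q, so (1 + α)-consistency forces 2q ≤ (1 + α)(p + q).  When c (1 + α) < 2 and
-- c ≥ 1, the weights q = 2(1 + α), p = (c − 1) q + (2 − c (1 + α)) make the first case lose a
-- factor c and the second case impossible; when c < 1, p = 0 and q = 1 suffice.

module Submission where

open import Defs
open import Data.Rational using (ℚ; 0ℚ; 1ℚ; _+_; _*_; _-_; -_; _≤_; _<_; positive; nonNegative)
import Data.Rational.Properties as ℚ
open import Data.Rational.Solver using (module +-*-Solver)
open import Data.Product using (Σ; _×_; _,_; proj₁; proj₂)
open import Data.Sum using (_⊎_; inj₁; inj₂)
open import Data.Nat as ℕ using (ℕ; s≤s; z≤n)
open import Data.List using (List; []; _∷_; lookup)
open import Data.List.Relation.Unary.Any using (here; there)
open import Data.List.Relation.Unary.All using ([]; _∷_)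
open import Data.List.Membership.Propositional using (_∈_)
open import Data.List.Relation.Binary.Subset.Propositional using (_⊆_)
open import Data.Maybe using (Maybe; just; nothing)
import Data.Maybe as Maybe
open import Data.Maybe.Properties using (≡-dec)
open import Data.Fin using (Fin; zero; suc)
open import Data.Empty using (⊥-elim)
open import Relation.Nullary using (¬_; yes; no)
open import Relation.Binary.PropositionalEquality
  using (_≡_; refl; sym; trans; cong; subst; subst₂; module ≡-Reasoning)

removeOne⇒∈ : ∀ {j} xs {ys} → removeOne j xs ≡ just ys → j ∈ xs
removeOne⇒∈ {j} (k ∷ ks) eq with j ≟J k
... | yes refl = here refl
... | no _ with removeOne j ks in eq′
...   | just _ = there (removeOne⇒∈ ks eq′)
removeOne⇒∈ {j} (k ∷ ks) () | no _ | nothing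

removeOne⇒⊆ : ∀ {j} xs {ys} → removeOne j xs ≡ just ys → ys ⊆ xs
removeOne⇒⊆ {j} (k ∷ ks) eq x∈ys with j ≟J k
removeOne⇒⊆ {j} (k ∷ ks) refl x∈ys | yes _ = there x∈ys
... | no _ with removeOne j ks in eq′
removeOne⇒⊆ {j} (k ∷ ks) refl (here x≡k)  | no _ | just _ = here x≡k
removeOne⇒⊆ {j} (k ∷ ks) refl (there x∈ys) | no _ | just _ = there (removeOne⇒⊆ ks eq′ x∈ys)
removeOne⇒⊆ {j} (k ∷ ks) () x∈ys | no _ | nothing

removeOne-head : ∀ j ks → removeOne j (j ∷ ks) ≡ just ks
removeOne-head j ks with j ≟J j
... | yes _ = refl
... | no j≢j = ⊥-elim (j≢j refl)

removeOne-skip : ∀ {j k} ks → ¬ j ≡ k → removeOne j (k ∷ ks) ≡ Maybe.map (k ∷_) (removeOne j ks)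
removeOne-skip {j} {k} ks j≢k with j ≟J k
... | yes j≡k = ⊥-elim (j≢k j≡k)
... | no _ = refl

data StepResult (A : Algorithm) (Ĵ J : Instance) (t : ℕ) (rem : List Job) : ℚ × List Job → Set where
  idle    : StepResult A Ĵ J t rem (0ℚ , rem)
  process : ∀ {j rem′} → A Ĵ t (released t J) ≡ just j → r j ℕ.≤ t → t ℕ.< d j →
            removeOne j rem ≡ just rem′ → StepResult A Ĵ J t rem (w j , rem′)

step-result : ∀ A Ĵ J t rem → StepResult A Ĵ J t rem (step A Ĵ J t rem)
step-result A Ĵ J t rem with A Ĵ t (released t J) in choice
... | nothing = idle
... | just j with r j ℕ.≤? t | t ℕ.<? d j | removeOne j rem in removed
...   | yes r≤t | yes t<d | just _ = process choice r≤t t<d removed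
...   | no _    | _       | _      = idle
...   | yes _   | no _    | _      = idle
...   | yes _   | yes _   | nothing = idle

step-chosen : ∀ A Ĵ J t {j rem rem′} → A Ĵ t (released t J) ≡ just j → r j ℕ.≤ t → t ℕ.< d j →
              removeOne j rem ≡ just rem′ → step A Ĵ J t rem ≡ (w j , rem′)
step-chosen A Ĵ J t {j} {rem} choice r≤t t<d removed with A Ĵ t (released t J) | choice
... | just .j | refl with r j ℕ.≤? t | t ℕ.<? d j | removeOne j rem | removed
...   | yes _ | yes _ | just _ | refl = refl
...   | no r≰t | _ | _ | _ = ⊥-elim (r≰t r≤t)
...   | yes _ | no t≮d | _ | _ = ⊥-elim (t≮d t<d)

step-⊆ : ∀ {A Ĵ J t rem g rem′} → StepResult A Ĵ J t rem (g , rem′) → rem′ ⊆ rem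
step-⊆ idle = λ x∈rem → x∈rem
step-⊆ (process _ _ _ removed) = removeOne⇒⊆ _ removed

urgent lax late : ℚ → Job
urgent p = job 0 1 p
lax    q = job 0 2 q
late   q = job 1 2 q

twoJobs threeJobs : ℚ → ℚ → Instance
twoJobs   p q = urgent p ∷ lax q ∷ []
threeJobs p q = urgent p ∷ lax q ∷ late q ∷ []

ZeroOr : ℚ → ℚ → Set
ZeroOr x g = g ≡ 0ℚ ⊎ g ≡ x

ZeroOr-bounds : ∀ {x g} → 0ℚ ≤ x → ZeroOr x g → 0ℚ ≤ g × g ≤ x
ZeroOr-bounds 0≤x (inj₁ refl) = ℚ.≤-refl , 0≤x
ZeroOr-bounds 0≤x (inj₂ refl) = 0≤x , ℚ.≤-refl

module _ (A : Algorithm) (p q : ℚ) where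

  lax-first-misses-urgent : A (threeJobs p q) 0 (twoJobs p q) ≡ just (lax q) →
                            ALG A (twoJobs p q) (threeJobs p q) ≡ q
  lax-first-misses-urgent choice = begin
    ALG A (twoJobs p q) (threeJobs p q)   ≡⟨ cong (λ s → proj₁ s + (gain₁ (proj₂ s) + 0ℚ)) first-step ⟩
    q + (gain₁ (urgent p ∷ []) + 0ℚ)      ≡⟨ cong (λ g → q + (g + 0ℚ)) (urgent-expired (step-result _ _ _ 1 _)) ⟩
    q + (0ℚ + 0ℚ)                         ≡⟨ ℚ.+-identityʳ q ⟩
    q                                     ∎
    where
    open ≡-Reasoning
    gain₁ : List Job → ℚ
    gain₁ rem = proj₁ (step A (threeJobs p q) (twoJobs p q) 1 rem)
    first-step : step A (threeJobs p q) (twoJobs p q) 0 (twoJobs p q) ≡ (q , urgent p ∷ [])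
    first-step = step-chosen A (threeJobs p q) (twoJobs p q) 0 choice z≤n (s≤s z≤n)
      (trans (removeOne-skip {lax q} {urgent p} (lax q ∷ []) λ ())
             (cong (Maybe.map (urgent p ∷_)) (removeOne-head (lax q) [])))
    urgent-expired : ∀ {s} → StepResult A (threeJobs p q) (twoJobs p q) 1 (urgent p ∷ []) s → proj₁ s ≡ 0ℚ
    urgent-expired idle = refl
    urgent-expired (process {j} _ _ 1<d removed) with removeOne⇒∈ {j} (urgent p ∷ []) removed | 1<d
    ... | here refl | s≤s ()

  gain₁-ZeroOr : ∀ {rem s} → rem ⊆ threeJobs p q →
                 StepResult A (threeJobs p q) (threeJobs p q) 1 rem s → ZeroOr q (proj₁ s)
  gain₁-ZeroOr rem⊆ idle = inj₁ refl
  gain₁-ZeroOr {rem} rem⊆ (process {j} _ _ 1<d removed) with rem⊆ (removeOne⇒∈ {j} rem removed) | 1<d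
  ... | here refl                 | s≤s ()
  ... | there (here refl)         | _ = inj₂ refl
  ... | there (there (here refl)) | _ = inj₂ refl

  module _ (lax-not-first : ¬ A (threeJobs p q) 0 (twoJobs p q) ≡ just (lax q)) where

    gain₀-ZeroOr : ∀ {s} → StepResult A (threeJobs p q) (threeJobs p q) 0 (threeJobs p q) s →
                   ZeroOr p (proj₁ s)
    gain₀-ZeroOr idle = inj₁ refl
    gain₀-ZeroOr (process {j} choice r≤0 _ removed) with removeOne⇒∈ {j} (threeJobs p q) removed | r≤0
    ... | here refl                 | _  = inj₂ refl
    ... | there (here refl)         | _  = ⊥-elim (lax-not-first choice)
    ... | there (there (here refl)) | ()

    correct-prediction-bounds : 0ℚ ≤ p → 0ℚ ≤ q →
      0ℚ ≤ ALG A (threeJobs p q) (threeJobs p q) × ALG A (threeJobs p q) (threeJobs p q) ≤ p + q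
    correct-prediction-bounds 0≤p 0≤q =
      subst (0ℚ ≤_) (sym two-slots) (ℚ.+-mono-≤ (proj₁ bounds₀) (proj₁ bounds₁)) ,
      subst (_≤ p + q) (sym two-slots) (ℚ.+-mono-≤ (proj₂ bounds₀) (proj₂ bounds₁))
      where
      J : Instance
      J = threeJobs p q
      g₀ g₁ : ℚ
      g₀ = proj₁ (step A J J 0 J)
      g₁ = proj₁ (step A J J 1 (proj₂ (step A J J 0 J)))
      two-slots : ALG A J J ≡ g₀ + g₁
      two-slots = cong (g₀ +_) (ℚ.+-identityʳ g₁)
      bounds₀ : 0ℚ ≤ g₀ × g₀ ≤ p
      bounds₀ = ZeroOr-bounds 0≤p (gain₀-ZeroOr (step-result A J J 0 J))
      bounds₁ : 0ℚ ≤ g₁ × g₁ ≤ q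
      bounds₁ = ZeroOr-bounds 0≤q (gain₁-ZeroOr (step-⊆ (step-result A J J 0 J)) (step-result A J J 1 _))

bothOnTime : Fin 2 → Maybe ℕ
bothOnTime zero       = just 0
bothOnTime (suc zero) = just 1

laxThenLate : Fin 3 → Maybe ℕ
laxThenLate zero             = nothing
laxThenLate (suc zero)       = just 0
laxThenLate (suc (suc zero)) = just 1

bothOnTime-feasible : ∀ p q → Feasible (twoJobs p q) bothOnTime
bothOnTime-feasible p q = within-windows , injective
  where
  within-windows : ∀ i t → bothOnTime i ≡ just t →
                   r (lookup (twoJobs p q) i) ℕ.≤ t × t ℕ.< d (lookup (twoJobs p q) i)
  within-windows zero       _ refl = z≤n , s≤s z≤n
  within-windows (suc zero) _ refl = z≤n , s≤s (s≤s z≤n)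
  injective : ∀ i k t → bothOnTime i ≡ just t → bothOnTime k ≡ just t → i ≡ k
  injective zero       zero       _ _    _  = refl
  injective zero       (suc zero) _ refl ()
  injective (suc zero) zero       _ refl ()
  injective (suc zero) (suc zero) _ _    _  = refl

laxThenLate-feasible : ∀ p q → Feasible (threeJobs p q) laxThenLate
laxThenLate-feasible p q = within-windows , injective
  where
  within-windows : ∀ i t → laxThenLate i ≡ just t →
                   r (lookup (threeJobs p q) i) ℕ.≤ t × t ℕ.< d (lookup (threeJobs p q) i)
  within-windows (suc zero)       _ refl = z≤n , s≤s z≤n
  within-windows (suc (suc zero)) _ refl = s≤s z≤n , s≤s (s≤s z≤n)
  injective : ∀ i k t → laxThenLate i ≡ just t → laxThenLate k ≡ just t → i ≡ k
  injective zero             _                _ ()   _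
  injective (suc zero)       zero             _ _    ()
  injective (suc zero)       (suc zero)       _ _    _  = refl
  injective (suc zero)       (suc (suc zero)) _ refl ()
  injective (suc (suc zero)) zero             _ _    ()
  injective (suc (suc zero)) (suc zero)       _ refl ()
  injective (suc (suc zero)) (suc (suc zero)) _ _    _  = refl

weight-bothOnTime : ∀ p q → weight (twoJobs p q) bothOnTime ≡ p + q
weight-bothOnTime p q = cong (p +_) (ℚ.+-identityʳ q)

weight-laxThenLate : ∀ p q → weight (threeJobs p q) laxThenLate ≡ q + q
weight-laxThenLate p q = trans (ℚ.+-identityˡ _) (cong (q +_) (ℚ.+-identityʳ q))

Beaten : Algorithm → ℚ → Set
Beaten A c = Σ Instance (λ J → Σ Instance (λ Ĵ → NonnegWeights J × NonnegWeights Ĵ ×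
  Σ (Schedule J) (λ σ → Feasible J σ × c * ALG A J Ĵ < weight J σ)))

-- x stands for A's gain on the correctly predicted three-job instance.
beaten-by : ∀ A β c p q → Consistent β A → 0ℚ ≤ p → 0ℚ ≤ q → c * q < p + q →
            (∀ x → 0ℚ ≤ x → x ≤ p + q → q + q ≤ β * x → c * x < q + q) → Beaten A c
beaten-by A β c p q consistent 0≤p 0≤q cq<p+q bound
  with ≡-dec _≟J_ (A (threeJobs p q) 0 (twoJobs p q)) (just (lax q))
... | yes lax-first =
  twoJobs p q , threeJobs p q , 0≤p ∷ 0≤q ∷ [] , 0≤p ∷ 0≤q ∷ 0≤q ∷ [] ,
  bothOnTime , bothOnTime-feasible p q ,
  subst₂ (λ x y → c * x < y) (sym (lax-first-misses-urgent A p q lax-first)) (sym (weight-bothOnTime p q)) cq<p+q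
... | no lax-not-first =
  threeJobs p q , threeJobs p q , nonneg , nonneg , laxThenLate , laxThenLate-feasible p q ,
  subst (c * alg <_) (sym (weight-laxThenLate p q))
    (bound alg (proj₁ alg-bounds) (proj₂ alg-bounds)
      (subst (_≤ β * alg) (weight-laxThenLate p q) (consistent _ nonneg laxThenLate (laxThenLate-feasible p q))))
  where
  nonneg : NonnegWeights (threeJobs p q)
  nonneg = 0≤p ∷ 0≤q ∷ 0≤q ∷ []
  alg : ℚ
  alg = ALG A (threeJobs p q) (threeJobs p q)
  alg-bounds : 0ℚ ≤ alg × alg ≤ p + q
  alg-bounds = correct-prediction-bounds A p q lax-not-first 0≤p 0≤q

two : ℚ
two = 1ℚ + 1ℚ

x<x+y : ∀ x {y} → 0ℚ < y → x < x + y
x<x+y x {y} 0<y = subst (_< x + y) (ℚ.+-identityʳ x) (ℚ.+-monoʳ-< x 0<y)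

module LargeRatio {c β : ℚ} (0<β : 0ℚ < β) (1≤c : 1ℚ ≤ c) (cβ<2 : c * β < two) where

  -- The first case needs (c − 1) q < p and the second β (p + q) < 2q; with cβ + slack = 2
  -- both hold with margin slack.
  slack q p : ℚ
  slack = two - c * β
  q     = two * β
  p     = (c - 1ℚ) * q + slack

  open +-*-Solver

  p+q≡cq+slack : p + q ≡ c * q + slack
  p+q≡cq+slack = solve 2 (λ c β → let t = con 1ℚ :+ con 1ℚ ; q = t :* β ; s = t :- c :* β in
    ((c :- con 1ℚ) :* q :+ s) :+ q := c :* q :+ s) refl c β

  β[p+q]+β*slack≡q+q : β * (p + q) + β * slack ≡ q + q
  β[p+q]+β*slack≡q+q = solve 2 (λ c β → let t = con 1ℚ :+ con 1ℚ ; q = t :* β ; s = t :- c :* β in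
    β :* (((c :- con 1ℚ) :* q :+ s) :+ q) :+ β :* s := q :+ q) refl c β

  0<slack : 0ℚ < slack
  0<slack = subst (_< slack) (ℚ.+-inverseʳ (c * β)) (ℚ.+-monoˡ-< (- (c * β)) cβ<2)

  0≤q : 0ℚ ≤ q
  0≤q = ℚ.*-monoˡ-≤-nonNeg two (ℚ.<⇒≤ 0<β)

  0≤p : 0ℚ ≤ p
  0≤p = ℚ.<⇒≤ (ℚ.+-mono-≤-< 0≤[c-1]q 0<slack)
    where
    0≤[c-1]q : 0ℚ ≤ (c - 1ℚ) * q
    0≤[c-1]q = subst (_≤ (c - 1ℚ) * q) (ℚ.*-zeroˡ q)
                 (ℚ.*-monoʳ-≤-nonNeg q ⦃ nonNegative 0≤q ⦄ (ℚ.+-monoˡ-≤ (- 1ℚ) 1≤c))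

  cq<p+q : c * q < p + q
  cq<p+q = subst (c * q <_) (sym p+q≡cq+slack) (x<x+y (c * q) 0<slack)

  consistency-fails : ∀ {x} → x ≤ p + q → ¬ q + q ≤ β * x
  consistency-fails {x} x≤p+q q+q≤βx = ℚ.<-irrefl refl (begin-strict
    q + q                  ≤⟨ q+q≤βx ⟩
    β * x                  ≤⟨ ℚ.*-monoˡ-≤-nonNeg β ⦃ nonNegative (ℚ.<⇒≤ 0<β) ⦄ x≤p+q ⟩
    β * (p + q)            <⟨ x<x+y (β * (p + q)) 0<β*slack ⟩
    β * (p + q) + β * slack ≡⟨ β[p+q]+β*slack≡q+q ⟩
    q + q                  ∎)
    where
    open ℚ.≤-Reasoning
    0<β*slack : 0ℚ < β * slack
    0<β*slack = subst (_< β * slack) (ℚ.*-zeroʳ β) (ℚ.*-monoʳ-<-pos β ⦃ positive 0<β ⦄ 0<slack)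

small-ratio-bound : ∀ {c x} → c < 1ℚ → 0ℚ ≤ x → x ≤ 1ℚ → c * x < two
small-ratio-bound {c} {x} c<1 0≤x x≤1 = begin-strict
  c * x   ≤⟨ ℚ.*-monoʳ-≤-nonNeg x ⦃ nonNegative 0≤x ⦄ (ℚ.<⇒≤ c<1) ⟩
  1ℚ * x  ≡⟨ ℚ.*-identityˡ x ⟩
  x       ≤⟨ x≤1 ⟩
  1ℚ      <⟨ ℚ.+-monoʳ-< 1ℚ (ℚ.positive⁻¹ 1ℚ) ⟩
  two     ∎
  where open ℚ.≤-Reasoning

theorem3 : (α : ℚ) → 0ℚ ≤ α → (A : Algorithm) → Consistent (1ℚ + α) A →
    (c : ℚ) → c * (1ℚ + α) < 1ℚ + 1ℚ →
    Σ Instance (λ J → Σ Instance (λ Ĵ → NonnegWeights J × NonnegWeights Ĵ ×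
      Σ (Schedule J) (λ σ → Feasible J σ × c * ALG A J Ĵ < weight J σ)))
theorem3 α 0≤α A consistent c cβ<2 with 1ℚ ℚ.≤? c
... | yes 1≤c = beaten-by A (1ℚ + α) c p q consistent 0≤p 0≤q cq<p+q
                  (λ _ _ x≤p+q q+q≤βx → ⊥-elim (consistency-fails x≤p+q q+q≤βx))
  where
  0<β : 0ℚ < 1ℚ + α
  0<β = ℚ.<-≤-trans (ℚ.positive⁻¹ 1ℚ) (ℚ.+-monoʳ-≤ 1ℚ 0≤α)
  open LargeRatio 0<β 1≤c cβ<2
... | no 1≰c = beaten-by A (1ℚ + α) c 0ℚ 1ℚ consistent ℚ.≤-refl (ℚ.nonNegative⁻¹ 1ℚ)
                 (subst (_< 1ℚ) (sym (ℚ.*-identityʳ c)) c<1)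
                 (λ _ 0≤x x≤1 _ → small-ratio-bound c<1 0≤x x≤1)
  where
  c<1 : c < 1ℚ
  c<1 = ℚ.≰⇒> 1≰c
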